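{- Let $G$ be a graph such that the components of $\overline{G}$ are all pendant trees. If $c$ is the number of components of $\overline{G}$, then $G$ is $N$-AW if and only if $\gcd(2c-1,\ell)=1$.
   Context: Neighborhood Lights Out game: vertices labeled from $\mathbb{Z}_\ell$; toggling a vertex $v$ adds 1 (mod $\ell$) to each label in the closed neighborhood $N[v]$; won when all labels are 0. A graph is $N$-AW if the game is winnable from every initial labeling. A pendant graph is a graph of the form $H\odot K_1$: obtained from a graph $H$ by adding, for each vertex $v$ of $H$, a new vertex adjacent only to $v$; a pendant tree is a pendant graph that is a tree. $\overline{G}$ is the complement of $G$. -}

module Defs where

open import Data.Nat using (ℕ; zero; suc; _+_; _*_)
open import Data.Bool using (Bool; true; false; _∨_; _∧_; not; if_then_else_)
open import Data.Fin using (Fin; zero; suc; toℕ; splitAt; inject₁; fromℕ)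
open import Data.Fin as F using ()
open import Data.Sum using (inj₁; inj₂)
open import Data.Product using (Σ; ∃; _×_; _,_)
open import Data.Nat.Divisibility using (_∣_)
open import Relation.Nullary.Decidable using (⌊_⌋)
open import Relation.Binary.PropositionalEquality using (_≡_; _≢_)
open import Function.Definitions using (Injective; Bijective)

Graph : ℕ → Set
Graph n = Fin n → Fin n → Bool

IsSimple : ∀ {n} → Graph n → Set
IsSimple {n} G = (∀ u v → G u v ≡ G v u) × (∀ v → G v v ≡ false)

complement : ∀ {n} → Graph n → Graph n
complement G u v = not (G u v) ∧ not ⌊ u F.≟ v ⌋

data Reach {n} (G : Graph n) : Fin n → Fin n → Set where
  here : ∀ {u} → Reach G u u
  step : ∀ {u w v} → G u w ≡ true → Reach G w v → Reach G u v

Connected : ∀ {n} → Graph n → Set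
Connected {n} G = ∀ (u v : Fin n) → Reach G u v

Cycle : ∀ {m} → Graph m → Set
Cycle {m} G = Σ ℕ λ k → Σ (Fin (suc (suc (suc k))) → Fin m) λ cyc →
  Injective _≡_ _≡_ cyc ×
  (∀ (i : Fin (suc (suc k))) → G (cyc (inject₁ i)) (cyc (suc i)) ≡ true) ×
  (G (cyc (fromℕ (suc (suc k)))) (cyc zero) ≡ true)

Acyclic : ∀ {m} → Graph m → Set
Acyclic G = Cycle G → Data.Empty.⊥
  where import Data.Empty

IsTree : ∀ {m} → Graph m → Set
IsTree G = Connected G × Acyclic G

-- Corona H ⊙ K₁: vertices Fin (k + k); the first copy is H, vertex (k + a)
-- is the pendant vertex attached to a.
corona : ∀ {k} → Graph k → Graph (k + k)
corona {k} H u v with splitAt k u | splitAt k v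
... | inj₁ a | inj₁ b = H a b
... | inj₁ a | inj₂ b = ⌊ a F.≟ b ⌋
... | inj₂ a | inj₁ b = ⌊ a F.≟ b ⌋
... | inj₂ a | inj₂ b = false

Isomorphic : ∀ {m n} → Graph m → Graph n → Set
Isomorphic {m} {n} G H = Σ (Fin m → Fin n) λ f →
  Bijective _≡_ _≡_ f × (∀ u v → H (f u) (f v) ≡ G u v)

IsPendantGraph : ∀ {m} → Graph m → Set
IsPendantGraph G = Σ ℕ λ k → Σ (Graph k) λ H → Isomorphic G (corona H)

IsPendantTree : ∀ {m} → Graph m → Set
IsPendantTree G = IsPendantGraph G × IsTree G

induced : ∀ {m n} → Graph n → (Fin m → Fin n) → Graph m
induced G ι a b = G (ι a) (ι b)

ComponentLabelling : ∀ {n} → Graph n → (c : ℕ) → (Fin n → Fin c) → Set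
ComponentLabelling {n} G c f =
  (∀ (i : Fin c) → ∃ λ v → f v ≡ i) ×
  (∀ u v → (f u ≡ f v → Reach G u v) × (Reach G u v → f u ≡ f v))

ComponentIsPendantTree : ∀ {n c} → Graph n → (Fin n → Fin c) → Fin c → Set
ComponentIsPendantTree {n} G f i = Σ ℕ λ m → Σ (Fin m → Fin n) λ ι →
  Injective _≡_ _≡_ ι ×
  (∀ a → f (ι a) ≡ i) ×
  (∀ v → f v ≡ i → ∃ λ a → ι a ≡ v) ×
  IsPendantTree (induced G ι)

sumFin : ∀ {n} → (Fin n → ℕ) → ℕ
sumFin {zero} x = 0
sumFin {suc n} x = x zero + sumFin (λ i → x (suc i))

inClosedNbhd : ∀ {n} → Graph n → Fin n → Fin n → Bool
inClosedNbhd G v u = ⌊ u F.≟ v ⌋ ∨ G v u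

-- Label change at v when each vertex u is toggled x u times.
toggleEffect : ∀ {n} → Graph n → (Fin n → ℕ) → Fin n → ℕ
toggleEffect G x v = sumFin (λ u → if inClosedNbhd G v u then x u else 0)

-- Neighborhood Lights Out over ℤ_ℓ: winnable from every initial labeling.
NAW : ∀ {n} → Graph n → ℕ → Set
NAW {n} G ℓ = ∀ (b : Fin n → Fin ℓ) → ∃ λ (x : Fin n → ℕ) →
  ∀ v → ℓ ∣ (toℕ (b v) + toggleEffect G x v)

module Submission where

-- Let A be the adjacency matrix of the complement Ḡ. In G the closed neighbourhood of v is everything
-- except the Ḡ-neighbours of v, so toggling x changes the labels by (J − A) x, J the all-ones matrix,
-- and G is N-AW iff J − A is invertible modulo ℓ. A graph whose components are pendant graphs H ⊙ K₁
-- has an explicit integral inverse of A, built from the matching of each vertex of H with its pendant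
-- vertex. With w = A⁻¹ 1 one has wᵀ (J − A) = (Σ w − 1) 1ᵀ, and J − A is invertible modulo ℓ exactly
-- when Σ w − 1 is (the matrix determinant lemma: det (J − A) = (−1)ⁿ det A (1 − 1ᵀ A⁻¹ 1)).
-- Finally Σ w = 2 n − Σ deg, and Σ deg = 2 (n − c) because Ḡ is a forest with c components.

open import Data.Nat as ℕ using (ℕ; zero; suc)
open import Data.Fin using (Fin; zero; suc; punchIn; _≟_)
open import Data.Bool using (Bool; true; false)
open import Data.Integer using (ℤ)
open import Data.Vec.Functional using (Vector)
open import Relation.Nullary using (¬_; yes; no)
open import Relation.Nullary.Decidable using (⌊_⌋)
open import Relation.Binary.PropositionalEquality
  using (_≡_; _≢_; refl; sym; trans; cong; cong₂; subst; subst₂; module ≡-Reasoning)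
open import Data.Empty using (⊥-elim)
open import Defs

⌊≟⌋-refl : ∀ {n} (u : Fin n) → ⌊ u ≟ u ⌋ ≡ true
⌊≟⌋-refl u with u ≟ u
... | yes _  = refl
... | no u≢u = ⊥-elim (u≢u refl)

⌊≟⌋⇒≡ : ∀ {n} {u v : Fin n} → ⌊ u ≟ v ⌋ ≡ true → u ≡ v
⌊≟⌋⇒≡ {u = u} {v} _ with u ≟ v
⌊≟⌋⇒≡ _  | yes u≡v = u≡v
⌊≟⌋⇒≡ () | no _

⌊≟⌋-sym : ∀ {n} (u v : Fin n) → ⌊ u ≟ v ⌋ ≡ ⌊ v ≟ u ⌋
⌊≟⌋-sym u v with u ≟ v | v ≟ u
... | yes _   | yes _   = refl
... | no _    | no _    = refl
... | yes u≡v | no v≢u  = ⊥-elim (v≢u (sym u≡v))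
... | no u≢v  | yes v≡u = ⊥-elim (u≢v (sym v≡u))

module IntegerMatrices where

  open import Data.Bool using (if_then_else_)
  open import Data.Fin.Properties using (punchInᵢ≢i)
  open import Data.Integer using (+_; _+_; _-_; -_; _*_; 0ℤ; 1ℤ; -1ℤ)
  open import Data.Integer.Properties using (+-*-semiring; +-identityʳ; *-identityʳ; *-zeroʳ; -1*i≡-i)
  open import Data.Integer.Divisibility.Signed using (_∣_; divides; ∣m∣n⇒∣m+n)
  open import Data.Integer.Tactic.RingSolver using (solve-∀)
  open ≡-Reasoning

  open import Algebra.Properties.Semiring.Sum +-*-semiring public
    using (sum; sum-cong-≗; ∑-distrib-+; ∑-comm; *-distribˡ-sum; *-distribʳ-sum; sum-remove; sum-replicate-zero)

  ones : ∀ {n} → Vector ℤ n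
  ones _ = 1ℤ

  sum-ones : ∀ n → sum (ones {n}) ≡ + n
  sum-ones zero    = refl
  sum-ones (suc n) = cong (_+_ 1ℤ) (sum-ones n)

  sum-neg : ∀ {n} (f : Vector ℤ n) → sum (λ i → - f i) ≡ - sum f
  sum-neg f = begin
    sum (λ i → - f i)     ≡⟨ sum-cong-≗ (λ i → sym (-1*i≡-i (f i))) ⟩
    sum (λ i → -1ℤ * f i) ≡⟨ *-distribˡ-sum -1ℤ f ⟨
    -1ℤ * sum f           ≡⟨ -1*i≡-i (sum f) ⟩
    - sum f               ∎

  sum-sub : ∀ {n} (f g : Vector ℤ n) → sum (λ i → f i - g i) ≡ sum f - sum g
  sum-sub f g = trans (∑-distrib-+ f (λ i → - g i)) (cong (_+_ (sum f)) (sum-neg g))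

  sum-pointSupported : ∀ {n} (f : Vector ℤ n) i → (∀ j → j ≢ i → f j ≡ 0ℤ) → sum f ≡ f i
  sum-pointSupported {suc n} f i vanish = begin
    sum f                             ≡⟨ sum-remove f ⟩
    f i + sum (λ j → f (punchIn i j)) ≡⟨ cong (_+_ (f i)) (sum-cong-≗ (λ j → vanish _ (punchInᵢ≢i i j))) ⟩
    f i + sum {n} (λ _ → 0ℤ)          ≡⟨ cong (_+_ (f i)) (sum-replicate-zero n) ⟩
    f i + 0ℤ                          ≡⟨ +-identityʳ (f i) ⟩
    f i                               ∎

  ∣-sum : ∀ {n d} (f : Vector ℤ n) → (∀ i → d ∣ f i) → d ∣ sum f
  ∣-sum {zero}  f _   = divides 0ℤ refl
  ∣-sum {suc n} f d∣f = ∣m∣n⇒∣m+n (d∣f zero) (∣-sum (λ i → f (suc i)) (λ i → d∣f (suc i)))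

  pos-sumFin : ∀ {n} (f : Fin n → ℕ) → + sumFin f ≡ sum (λ i → + f i)
  pos-sumFin {zero}  f = refl
  pos-sumFin {suc n} f = cong (_+_ (+ f zero)) (pos-sumFin (λ i → f (suc i)))

  Matrix : ℕ → Set
  Matrix n = Fin n → Fin n → ℤ

  infix  8 J-_
  infixr 7 _·ᵥ_

  _·ᵥ_ : ∀ {n} → Matrix n → Vector ℤ n → Vector ℤ n
  (M ·ᵥ x) i = sum (λ j → M i j * x j)

  ⟨_,_⟩ : ∀ {n} → Vector ℤ n → Vector ℤ n → ℤ
  ⟨ x , y ⟩ = sum (λ i → x i * y i)

  unit : ∀ {n} → Fin n → Vector ℤ n
  unit a i = if ⌊ i ≟ a ⌋ then 1ℤ else 0ℤ

  ⟨⟩-unit : ∀ {n} (x : Vector ℤ n) a → ⟨ x , unit a ⟩ ≡ x a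
  ⟨⟩-unit x a = begin
    ⟨ x , unit a ⟩                          ≡⟨ sum-pointSupported (λ i → x i * unit a i) a off ⟩
    x a * (if ⌊ a ≟ a ⌋ then 1ℤ else 0ℤ)  ≡⟨ cong (λ β → x a * (if β then 1ℤ else 0ℤ)) (⌊≟⌋-refl a) ⟩
    x a * 1ℤ                                ≡⟨ *-identityʳ (x a) ⟩
    x a                                     ∎
    where off : ∀ i → i ≢ a → x i * unit a i ≡ 0ℤ
          off i i≢a with i ≟ a
          ... | yes i≡a = ⊥-elim (i≢a i≡a)
          ... | no _    = *-zeroʳ (x i)

  J-_ : ∀ {n} → Matrix n → Matrix n
  (J- M) i j = 1ℤ - M i j

  J-·ᵥ : ∀ {n} (M : Matrix n) x i → (J- M ·ᵥ x) i ≡ sum x - (M ·ᵥ x) i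
  J-·ᵥ M x i = trans (sum-cong-≗ (λ j → distrib (M i j) (x j))) (sum-sub x (λ j → M i j * x j))
    where distrib : ∀ a b → (1ℤ - a) * b ≡ b - a * b
          distrib = solve-∀

  module _ {n} (M : Matrix n) where

    ·ᵥ-cong : ∀ {x y : Vector ℤ n} → (∀ j → x j ≡ y j) → ∀ i → (M ·ᵥ x) i ≡ (M ·ᵥ y) i
    ·ᵥ-cong x≗y i = sum-cong-≗ (λ j → cong (M i j *_) (x≗y j))

    ·ᵥ-+ : ∀ (x y : Vector ℤ n) i → (M ·ᵥ (λ j → x j + y j)) i ≡ (M ·ᵥ x) i + (M ·ᵥ y) i
    ·ᵥ-+ x y i = trans (sum-cong-≗ (λ j → distrib (M i j) (x j) (y j)))
                       (∑-distrib-+ (λ j → M i j * x j) (λ j → M i j * y j))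
      where distrib : ∀ a b c → a * (b + c) ≡ a * b + a * c
            distrib = solve-∀

    ·ᵥ-sub : ∀ (x y : Vector ℤ n) i → (M ·ᵥ (λ j → x j - y j)) i ≡ (M ·ᵥ x) i - (M ·ᵥ y) i
    ·ᵥ-sub x y i = trans (sum-cong-≗ (λ j → distrib (M i j) (x j) (y j)))
                         (sum-sub (λ j → M i j * x j) (λ j → M i j * y j))
      where distrib : ∀ a b c → a * (b - c) ≡ a * b - a * c
            distrib = solve-∀

    ·ᵥ-scale : ∀ s (x : Vector ℤ n) i → (M ·ᵥ (λ j → s * x j)) i ≡ s * (M ·ᵥ x) i
    ·ᵥ-scale s x i = trans (sum-cong-≗ (λ j → swap (M i j) s (x j))) (sym (*-distribˡ-sum s (λ j → M i j * x j)))
      where swap : ∀ a b c → a * (b * c) ≡ b * (a * c)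
            swap = solve-∀

    ⟨⟩-adjoint : (∀ i j → M i j ≡ M j i) → ∀ x y → ⟨ x , M ·ᵥ y ⟩ ≡ ⟨ M ·ᵥ x , y ⟩
    ⟨⟩-adjoint M-sym x y = begin
      sum (λ i → x i * sum (λ j → M i j * y j))
        ≡⟨ sum-cong-≗ (λ i → *-distribˡ-sum (x i) (λ j → M i j * y j)) ⟩
      sum (λ i → sum (λ j → x i * (M i j * y j)))
        ≡⟨ ∑-comm (λ i j → x i * (M i j * y j)) ⟩
      sum (λ j → sum (λ i → x i * (M i j * y j)))
        ≡⟨ sum-cong-≗ (λ j → sum-cong-≗ (λ i → reorder (x i) (y j) (M-sym i j))) ⟩
      sum (λ j → sum (λ i → M j i * x i * y j))
        ≡⟨ sum-cong-≗ (λ j → *-distribʳ-sum (y j) (λ i → M j i * x i)) ⟨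
      sum (λ j → sum (λ i → M j i * x i) * y j) ∎
      where reorder : ∀ a c {b b′} → b ≡ b′ → a * (b * c) ≡ b′ * a * c
            reorder a c {b} refl = comm a b c
              where comm : ∀ a b c → a * (b * c) ≡ b * a * c
                    comm = solve-∀

module ModularInverse where

  open import Data.Nat.GCD using (gcd; module Bézout)
  open import Data.Nat.Coprimality using (gcd≡1⇒coprime; coprime-Bézout)
  open import Data.Integer using (+_; _+_; _-_; -_; _*_; 1ℤ)
  open import Data.Integer.Properties using (pos-*)
  open import Data.Integer.Divisibility.Signed using (_∣_; divides)
  open import Data.Integer.Tactic.RingSolver using (solve-∀)
  open import Data.Product using (∃; _,_)
  open ≡-Reasoning

  gcd≡1⇒invertible-mod : ∀ {m ℓ} → gcd m ℓ ≡ 1 → ∃ λ t → + ℓ ∣ t * + m - 1ℤ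
  gcd≡1⇒invertible-mod {m} {ℓ} gcd≡1 with coprime-Bézout (gcd≡1⇒coprime gcd≡1)
  ... | Bézout.+- x y 1+yℓ≡xm = + x , divides (+ y) (begin
    + x * + m - 1ℤ        ≡⟨ cong (_- 1ℤ) (pos-* x m) ⟨
    + (x ℕ.* m) - 1ℤ      ≡⟨ cong (λ k → + k - 1ℤ) 1+yℓ≡xm ⟨
    1ℤ + + (y ℕ.* ℓ) - 1ℤ ≡⟨ cong (λ k → 1ℤ + k - 1ℤ) (pos-* y ℓ) ⟩
    1ℤ + + y * + ℓ - 1ℤ   ≡⟨ cancel (+ y * + ℓ) ⟩
    + y * + ℓ             ∎)
    where cancel : ∀ a → 1ℤ + a - 1ℤ ≡ a
          cancel = solve-∀
  ... | Bézout.-+ x y 1+xm≡yℓ = - + x , divides (- + y) (begin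
    - + x * + m - 1ℤ      ≡⟨ negate (+ x) (+ m) ⟩
    - (1ℤ + + x * + m)    ≡⟨ cong (λ k → - (1ℤ + k)) (pos-* x m) ⟨
    - + (1 ℕ.+ x ℕ.* m)   ≡⟨ cong (λ k → - + k) 1+xm≡yℓ ⟩
    - + (y ℕ.* ℓ)         ≡⟨ cong -_ (pos-* y ℓ) ⟩
    - (+ y * + ℓ)         ≡⟨ neg-* (+ y) (+ ℓ) ⟩
    - + y * + ℓ           ∎)
    where negate : ∀ a b → - a * b - 1ℤ ≡ - (1ℤ + a * b)
          negate = solve-∀
          neg-* : ∀ a b → - (a * b) ≡ - a * b
          neg-* = solve-∀

module SolvabilityOfJ-M {n} (M : IntegerMatrices.Matrix n) (M-sym : ∀ i j → M i j ≡ M j i)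
  (Y : Vector ℤ n → Vector ℤ n) (M·ᵥY : ∀ b i → IntegerMatrices._·ᵥ_ M (Y b) i ≡ b i) where

  open IntegerMatrices
  open ModularInverse using (gcd≡1⇒invertible-mod)
  open import Data.Nat.GCD using (gcd; gcd[m,n]∣m; gcd[m,n]∣n)
  open import Data.Nat.Divisibility using (∣1⇒≡1)
  open import Data.Integer using (+_; _+_; _-_; -_; _*_; 1ℤ)
  open import Data.Integer.Properties using (*-distribˡ-+; *-identityˡ; *-identityʳ)
  open import Data.Integer.Divisibility.Signed using (_∣_; ∣ᵤ⇒∣; ∣⇒∣ᵤ; ∣m+n∣n⇒∣m; ∣-trans; ∣n⇒∣m*n; ∣m⇒∣m*n)
  open import Data.Integer.Tactic.RingSolver using (solve-∀)
  open import Data.Product using (∃; _,_)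
  open ≡-Reasoning

  w : Vector ℤ n
  w = Y ones

  ⟨w,J-M·ᵥ⟩ : ∀ x → ⟨ w , J- M ·ᵥ x ⟩ ≡ (sum w - 1ℤ) * sum x
  ⟨w,J-M·ᵥ⟩ x = begin
    ⟨ w , J- M ·ᵥ x ⟩
      ≡⟨ sum-cong-≗ (λ i → cong (w i *_) (J-·ᵥ M x i)) ⟩
    sum (λ i → w i * (sum x - (M ·ᵥ x) i))
      ≡⟨ sum-cong-≗ (λ i → distrib (w i) (sum x) ((M ·ᵥ x) i)) ⟩
    sum (λ i → sum x * w i - w i * (M ·ᵥ x) i)
      ≡⟨ sum-sub (λ i → sum x * w i) (λ i → w i * (M ·ᵥ x) i) ⟩
    sum (λ i → sum x * w i) - ⟨ w , M ·ᵥ x ⟩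
      ≡⟨ cong₂ _-_ (sym (*-distribˡ-sum (sum x) w)) (⟨⟩-adjoint M M-sym w x) ⟩
    sum x * sum w - ⟨ M ·ᵥ w , x ⟩
      ≡⟨ cong (_-_ (sum x * sum w)) (sum-cong-≗ (λ i → cong (_* x i) (M·ᵥY ones i))) ⟩
    sum x * sum w - sum (λ i → 1ℤ * x i)
      ≡⟨ cong (_-_ (sum x * sum w)) (sum-cong-≗ (λ i → *-identityˡ (x i))) ⟩
    sum x * sum w - sum x
      ≡⟨ factor (sum x) (sum w) ⟩
    (sum w - 1ℤ) * sum x ∎
    where distrib : ∀ a s m → a * (s - m) ≡ s * a - a * m
          distrib = solve-∀
          factor : ∀ s t → s * t - s ≡ (t - 1ℤ) * s
          factor = solve-∀

  ⟨w,b+J-M·ᵥx⟩ : ∀ b x → ⟨ w , (λ i → b i + (J- M ·ᵥ x) i) ⟩ ≡ ⟨ w , b ⟩ + (sum w - 1ℤ) * sum x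
  ⟨w,b+J-M·ᵥx⟩ b x = begin
    ⟨ w , (λ i → b i + (J- M ·ᵥ x) i) ⟩
      ≡⟨ sum-cong-≗ (λ i → *-distribˡ-+ (w i) (b i) ((J- M ·ᵥ x) i)) ⟩
    sum (λ i → w i * b i + w i * (J- M ·ᵥ x) i)
      ≡⟨ ∑-distrib-+ (λ i → w i * b i) (λ i → w i * (J- M ·ᵥ x) i) ⟩
    ⟨ w , b ⟩ + ⟨ w , J- M ·ᵥ x ⟩
      ≡⟨ cong (_+_ ⟨ w , b ⟩) (⟨w,J-M·ᵥ⟩ x) ⟩
    ⟨ w , b ⟩ + (sum w - 1ℤ) * sum x ∎

  module _ {m ℓ : ℕ} (Σw-1≡m : sum w - 1ℤ ≡ + m) where

    -- Pairing a solution for the labelling unit a with w shows that gcd m ℓ divides every w a,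
    -- hence also (M ·ᵥ w) i₀ = 1.
    solvable⇒coprime : Fin n → (∀ a → ∃ λ x → ∀ i → + ℓ ∣ unit a i + (J- M ·ᵥ x) i) → gcd m ℓ ≡ 1
    solvable⇒coprime i₀ solvable = ∣1⇒≡1 (∣⇒∣ᵤ d∣1)
      where
      d = gcd m ℓ
      d∣m : + d ∣ + m
      d∣m = ∣ᵤ⇒∣ (gcd[m,n]∣m m ℓ)
      d∣ℓ : + d ∣ + ℓ
      d∣ℓ = ∣ᵤ⇒∣ (gcd[m,n]∣n m ℓ)
      d∣w : ∀ a → + d ∣ w a
      d∣w a with x , ℓ∣ ← solvable a = ∣m+n∣n⇒∣m d∣wa+mΣx (∣m⇒∣m*n (sum x) d∣m)
        where
        d∣wa+mΣx : + d ∣ w a + + m * sum x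
        d∣wa+mΣx = subst (+ d ∣_)
          (trans (⟨w,b+J-M·ᵥx⟩ (unit a) x) (cong₂ _+_ (⟨⟩-unit w a) (cong (_* sum x) Σw-1≡m)))
          (∣-trans d∣ℓ (∣-sum _ (λ i → ∣n⇒∣m*n (w i) (ℓ∣ i))))
      d∣1 : + d ∣ 1ℤ
      d∣1 = subst (+ d ∣_) (M·ᵥY ones i₀) (∣-sum _ (λ j → ∣n⇒∣m*n (M i₀ j) (d∣w j)))

    -- For x = c w + Y b every entry of b + (J − M) x is c (Σ w − 1) + Σ Y b; taking c = − (Σ Y b) t
    -- with t an inverse of m modulo ℓ makes it divisible by ℓ.
    coprime⇒solvable : gcd m ℓ ≡ 1 → ∀ b → ∃ λ x → ∀ i → + ℓ ∣ b i + (J- M ·ᵥ x) i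
    coprime⇒solvable gcd≡1 b with t , ℓ∣tm-1 ← gcd≡1⇒invertible-mod gcd≡1 = x , ℓ∣b+J-M·ᵥx
      where
      s = sum (Y b)
      c = - (s * t)
      x : Vector ℤ n
      x i = c * w i + Y b i
      Σx : sum x ≡ c * sum w + s
      Σx = trans (∑-distrib-+ (λ i → c * w i) (Y b)) (cong (_+ s) (sym (*-distribˡ-sum c w)))
      M·ᵥx : ∀ i → (M ·ᵥ x) i ≡ c + b i
      M·ᵥx i = begin
        (M ·ᵥ x) i                              ≡⟨ ·ᵥ-+ M (λ j → c * w j) (Y b) i ⟩
        (M ·ᵥ (λ j → c * w j)) i + (M ·ᵥ Y b) i ≡⟨ cong₂ _+_ (·ᵥ-scale M c w i) (M·ᵥY b i) ⟩
        c * (M ·ᵥ w) i + b i                    ≡⟨ cong (λ k → c * k + b i) (M·ᵥY ones i) ⟩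
        c * 1ℤ + b i                            ≡⟨ cong (_+ b i) (*-identityʳ c) ⟩
        c + b i                                 ∎
      ℓ∣b+J-M·ᵥx : ∀ i → + ℓ ∣ b i + (J- M ·ᵥ x) i
      ℓ∣b+J-M·ᵥx i = subst (+ ℓ ∣_) (sym (begin
        b i + (J- M ·ᵥ x) i               ≡⟨ cong (_+_ (b i)) (J-·ᵥ M x i) ⟩
        b i + (sum x - (M ·ᵥ x) i)        ≡⟨ cong₂ (λ p q → b i + (p - q)) Σx (M·ᵥx i) ⟩
        b i + (c * sum w + s - (c + b i)) ≡⟨ collect (b i) c (sum w) s ⟩
        c * (sum w - 1ℤ) + s              ≡⟨ cong (λ k → c * k + s) Σw-1≡m ⟩
        - (s * t) * + m + s               ≡⟨ factor s t (+ m) ⟩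
        - s * (t * + m - 1ℤ)              ∎))
        (∣n⇒∣m*n (- s) ℓ∣tm-1)
        where collect : ∀ b c W s → b + (c * W + s - (c + b)) ≡ c * (W - 1ℤ) + s
              collect = solve-∀
              factor : ∀ s t m → - (s * t) * m + s ≡ - s * (t * m - 1ℤ)
              factor = solve-∀

module GraphBasics where

  open IntegerMatrices
  open import Data.Bool using (not; _∧_; _∨_; if_then_else_)
  open import Data.Bool.Properties using (∧-zeroʳ)
  open import Data.Integer using (+_; _-_; _*_; 0ℤ; 1ℤ)
  open import Data.Integer.Properties using (*-zeroˡ; *-identityˡ)
  open import Data.Product using (_,_; proj₂)
  open import Function.Definitions using (Injective)

  Symmetric : ∀ {n} → Graph n → Set
  Symmetric A = ∀ u v → A u v ≡ A v u

  Loopless : ∀ {n} → Graph n → Set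
  Loopless A = ∀ v → A v v ≡ false

  true≢false : true ≢ false
  true≢false ()

  complement-symmetric : ∀ {n} {G : Graph n} → Symmetric G → Symmetric (complement G)
  complement-symmetric G-sym u v = cong₂ (λ a b → not a ∧ not b) (G-sym u v) (⌊≟⌋-sym u v)

  complement-loopless : ∀ {n} (G : Graph n) → Loopless (complement G)
  complement-loopless G v = trans (cong (λ b → not (G v v) ∧ not b) (⌊≟⌋-refl v)) (∧-zeroʳ _)

  inClosedNbhd≡not-complement : ∀ {n} (G : Graph n) v u → inClosedNbhd G v u ≡ not (complement G v u)
  inClosedNbhd≡not-complement G v u = trans (cong (_∨ G v u) (⌊≟⌋-sym u v)) (deMorgan ⌊ v ≟ u ⌋ (G v u))
    where deMorgan : ∀ a b → a ∨ b ≡ not (not b ∧ not a)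
          deMorgan true  true  = refl
          deMorgan true  false = refl
          deMorgan false true  = refl
          deMorgan false false = refl

  χ : Bool → ℤ
  χ true  = 1ℤ
  χ false = 0ℤ

  adjacencyMatrix : ∀ {n} → Graph n → Matrix n
  adjacencyMatrix A u v = χ (A u v)

  degree : ∀ {n} → Graph n → Vector ℤ n
  degree A v = sum (λ u → χ (A v u))

  toggleEffect≡J-Ḡ·ᵥ : ∀ {n} (G : Graph n) x v →
    + toggleEffect G x v ≡ (J- adjacencyMatrix (complement G) ·ᵥ (λ u → + x u)) v
  toggleEffect≡J-Ḡ·ᵥ G x v =
    trans (pos-sumFin (λ u → if inClosedNbhd G v u then x u else 0)) (sum-cong-≗ (λ u →
      trans (cong (λ b → + (if b then x u else 0)) (inClosedNbhd≡not-complement G v u))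
            (term (complement G v u) (x u))))
    where term : ∀ b k → + (if not b then k else 0) ≡ (1ℤ - χ b) * + k
          term true  k = sym (*-zeroˡ (+ k))
          term false k = sym (*-identityˡ (+ k))

  adjacent⇒sameLabel : ∀ {n c} {A : Graph n} {f} → ComponentLabelling A c f → ∀ {u v} → A u v ≡ true → f u ≡ f v
  adjacent⇒sameLabel (_ , reach) e = proj₂ (reach _ _) (step e here)

  induced-reach : ∀ {m n} (A : Graph n) (ι : Fin m → Fin n) {x y} → Reach (induced A ι) x y → Reach A (ι x) (ι y)
  induced-reach A ι here       = here
  induced-reach A ι (step e r) = step e (induced-reach A ι r)

  induced-acyclic : ∀ {m n} (A : Graph n) {ι : Fin m → Fin n} → Injective _≡_ _≡_ ι →
                    Acyclic A → Acyclic (induced A ι)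
  induced-acyclic A {ι} ι-injective acyclic (k , cycle , cycle-injective , edges , closing) =
    acyclic (k , (λ t → ι (cycle t)) , (λ e → cycle-injective (ι-injective e)) , edges , closing)

module Repetitions where

  open import Data.Nat using (_<_; _+_)
  open import Data.Nat.Properties using (+-comm; +-suc; +-identityʳ; m≤n⇒∃[o]m+o≡n; m<1+n⇒m<n∨m≡n; n<1+n; <⇒≢)
  open import Data.Fin using (toℕ; fromℕ<)
  open import Data.Fin.Properties using (any?; toℕ<n; toℕ-fromℕ<; pigeonhole)
  open import Data.Product using (∃; _×_; _,_)
  open import Data.Sum using (inj₁; inj₂)

  InjectiveBelow : ∀ {m} → (ℕ → Fin m) → ℕ → Set
  InjectiveBelow W j = ∀ {a b} → a < j → b < j → W a ≡ W b → a ≡ b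

  -- The gap is added on the left, suc o + i = suc (o + i), so consecutive indices stay definitional.
  FirstRepetition : ∀ {m} → (ℕ → Fin m) → Set
  FirstRepetition W = ∃ λ i → ∃ λ o → W i ≡ W (suc o + i) × InjectiveBelow W (suc o + i)

  <⇒∃[o]1+o+m≡n : ∀ {m n} → m < n → ∃ λ o → suc o + m ≡ n
  <⇒∃[o]1+o+m≡n {m} m<n with o , 1+m+o≡n ← m≤n⇒∃[o]m+o≡n m<n = o , trans (cong suc (+-comm o m)) 1+m+o≡n

  injectiveBelow-extend : ∀ {m} {W : ℕ → Fin m} {j} → InjectiveBelow W j →
                          (∀ (i : Fin j) → W (toℕ i) ≢ W j) → InjectiveBelow W (suc j)
  injectiveBelow-extend {W = W} injective fresh a<1+j b<1+j Wa≡Wb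
    with m<1+n⇒m<n∨m≡n a<1+j | m<1+n⇒m<n∨m≡n b<1+j
  ... | inj₁ a<j  | inj₁ b<j  = injective a<j b<j Wa≡Wb
  ... | inj₂ a≡j  | inj₂ b≡j  = trans a≡j (sym b≡j)
  ... | inj₁ a<j  | inj₂ refl = ⊥-elim (fresh (fromℕ< a<j) (trans (cong W (toℕ-fromℕ< a<j)) Wa≡Wb))
  ... | inj₂ refl | inj₁ b<j  = ⊥-elim (fresh (fromℕ< b<j) (trans (cong W (toℕ-fromℕ< b<j)) (sym Wa≡Wb)))

  ¬injectiveBelow-suc : ∀ {m} (W : ℕ → Fin m) → ¬ InjectiveBelow W (suc m)
  ¬injectiveBelow-suc {m} W injective with i , j , i<j , Wi≡Wj ← pigeonhole (n<1+n m) (λ t → W (toℕ t)) =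
    <⇒≢ i<j (injective (toℕ<n i) (toℕ<n j) Wi≡Wj)

  firstRepetition : ∀ {m} (W : ℕ → Fin m) → FirstRepetition W
  firstRepetition {m} W = scan (suc m) 0 (+-identityʳ (suc m)) (λ ())
    where
    scan : ∀ fuel j → fuel + j ≡ suc m → InjectiveBelow W j → FirstRepetition W
    scan fuel j _ injective with any? (λ (i : Fin j) → W (toℕ i) ≟ W j)
    ... | yes (i , Wi≡Wj) with o , 1+o+i≡j ← <⇒∃[o]1+o+m≡n (toℕ<n i) =
      toℕ i , o , subst (λ k → W (toℕ i) ≡ W k × InjectiveBelow W k) (sym 1+o+i≡j) (Wi≡Wj , injective)
    scan zero       j j≡1+m injective | no _ =
      ⊥-elim (¬injectiveBelow-suc W (subst (InjectiveBelow W) j≡1+m injective))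
    scan (suc fuel) j e     injective | no fresh =
      scan fuel (suc j) (trans (+-suc fuel j) e)
           (injectiveBelow-extend injective (λ i Wi≡Wj → fresh (i , Wi≡Wj)))

module Forests where

  open IntegerMatrices
  open GraphBasics
  open Repetitions
  open import Data.Bool.Properties using (¬-not) renaming (_≟_ to _≟ᵇ_)
  open import Data.Nat.Properties using (+-cancelʳ-≡; +-monoˡ-<)
  open import Data.Fin using (toℕ; inject₁; fromℕ; punchOut)
  open import Data.Fin.Properties
    using (punchIn-injective; punchInᵢ≢i; punchIn-punchOut; punchOut-cong; punchOut-injective; punchOut-punchIn;
           any?; toℕ<n; toℕ-injective; toℕ-inject₁; toℕ-fromℕ)
  open import Data.Integer using (+_; _+_; _-_; _*_; 0ℤ; 1ℤ)
  open import Data.Integer.Properties using (+-assoc; +-identityˡ)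
  open import Data.Integer.Tactic.RingSolver using (solve-∀)
  open import Data.Product using (∃; _×_; _,_; proj₁; proj₂)
  open import Data.Sum using (_⊎_; inj₁; inj₂)
  open import Relation.Nullary using (Dec; ¬?)
  open import Relation.Nullary.Decidable using (_×-dec_; decidable-stable)
  open ≡-Reasoning

  nonBacktrackingWalk⇒cycle : ∀ {m} {A : Graph m} → Loopless A → (W : ℕ → Fin m) →
    (∀ k → A (W k) (W (suc k)) ≡ true) → (∀ k → W (suc (suc k)) ≢ W k) → Cycle A
  nonBacktrackingWalk⇒cycle {A = A} loopless W adjacent nonBacktracking with firstRepetition W
  ... | i , zero , Wi≡W1+i , _ =
    ⊥-elim (true≢false (trans (sym (adjacent i)) (trans (cong (A (W i)) (sym Wi≡W1+i)) (loopless (W i)))))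
  ... | i , suc zero , Wi≡W2+i , _ = ⊥-elim (nonBacktracking i (sym Wi≡W2+i))
  ... | i , suc (suc k) , Wi≡W3+k+i , injective = k , cycle , cycle-injective , edges , closing
    where
    cycle : Fin (suc (suc (suc k))) → Fin _
    cycle t = W (toℕ t ℕ.+ i)
    cycle-injective : ∀ {t₁ t₂} → cycle t₁ ≡ cycle t₂ → t₁ ≡ t₂
    cycle-injective {t₁} {t₂} e =
      toℕ-injective (+-cancelʳ-≡ i _ _ (injective (+-monoˡ-< i (toℕ<n t₁)) (+-monoˡ-< i (toℕ<n t₂)) e))
    edges : ∀ t → A (cycle (inject₁ t)) (cycle (suc t)) ≡ true
    edges t = subst (λ j → A (W (j ℕ.+ i)) (W (suc (toℕ t) ℕ.+ i)) ≡ true) (sym (toℕ-inject₁ t))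
                    (adjacent (toℕ t ℕ.+ i))
    closing : A (cycle (fromℕ (suc (suc k)))) (cycle zero) ≡ true
    closing = subst₂ (λ j x → A (W (j ℕ.+ i)) x ≡ true) (sym (toℕ-fromℕ (suc (suc k)))) (sym Wi≡W3+k+i)
                     (adjacent (suc (suc k) ℕ.+ i))

  TwoNeighbours : ∀ {m} → Graph m → Fin m → Set
  TwoNeighbours A v = ∃ λ u → ∃ λ u′ → u ≢ u′ × A v u ≡ true × A v u′ ≡ true

  twoNeighbours? : ∀ {m} (A : Graph m) v → Dec (TwoNeighbours A v)
  twoNeighbours? A v = any? λ u → any? λ u′ → ¬? (u ≟ u′) ×-dec (A v u ≟ᵇ true) ×-dec (A v u′ ≟ᵇ true)

  twoNeighbours⇒cycle : ∀ {m} {A : Graph m} → Loopless A → Fin m → (∀ v → TwoNeighbours A v) → Cycle A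
  twoNeighbours⇒cycle {m} {A} loopless v₀ two =
    nonBacktrackingWalk⇒cycle {A = A} loopless W adjacent nonBacktracking
    where
    next : ∀ p c → ∃ λ u → A c u ≡ true × u ≢ p
    next p c with u , u′ , u≢u′ , cu , cu′ ← two c with u ≟ p
    ... | yes u≡p = u′ , cu′ , λ u′≡p → u≢u′ (trans u≡p (sym u′≡p))
    ... | no u≢p  = u , cu , u≢p
    start : ∃ λ u → A v₀ u ≡ true
    start = let u , _ , _ , v₀u , _ = two v₀ in u , v₀u
    walk : ℕ → Fin m × Fin m
    walk zero    = v₀ , proj₁ start
    walk (suc k) with p , c ← walk k = c , proj₁ (next p c)
    W : ℕ → Fin m
    W k = proj₁ (walk k)
    adjacent : ∀ k → A (W k) (W (suc k)) ≡ true
    adjacent zero    = proj₂ start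
    adjacent (suc k) = proj₁ (proj₂ (next (W k) (W (suc k))))
    nonBacktracking : ∀ k → W (suc (suc k)) ≢ W k
    nonBacktracking k = proj₂ (proj₂ (next (W k) (W (suc k))))

  AtMostOneNeighbour : ∀ {m} → Graph m → Fin m → Set
  AtMostOneNeighbour A v = ∀ {u u′} → A v u ≡ true → A v u′ ≡ true → u ≡ u′

  acyclic⇒atMostOneNeighbour : ∀ {m} {A : Graph m} → Loopless A → Acyclic A → Fin m → ∃ (AtMostOneNeighbour A)
  acyclic⇒atMostOneNeighbour {A = A} loopless acyclic v₀ with any? (λ v → ¬? (twoNeighbours? A v))
  ... | yes (v , ¬two) =
    v , λ {u} {u′} e e′ → decidable-stable (u ≟ u′) (λ u≢u′ → ¬two (u , u′ , u≢u′ , e , e′))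
  ... | no ¬∃¬two = ⊥-elim (acyclic (twoNeighbours⇒cycle loopless v₀ two))
    where two : ∀ v → TwoNeighbours A v
          two v = decidable-stable (twoNeighbours? A v) (λ ¬two → ¬∃¬two (v , ¬two))

  neighbour-or-isolated : ∀ {m} (A : Graph m) v → (∃ λ u → A v u ≡ true) ⊎ (∀ u → A v u ≡ false)
  neighbour-or-isolated A v with any? (λ u → A v u ≟ᵇ true)
  ... | yes neighbour  = inj₁ neighbour
  ... | no ¬neighbour = inj₂ (λ u → ¬-not (λ vu → ¬neighbour (u , vu)))

  degree-isolated : ∀ {m} (A : Graph m) {v} → (∀ u → A v u ≡ false) → degree A v ≡ 0ℤ
  degree-isolated {m} A isolated = trans (sum-cong-≗ (λ u → cong χ (isolated u))) (sum-replicate-zero m)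

  degree-pendant : ∀ {m} (A : Graph m) {v u} → AtMostOneNeighbour A v → A v u ≡ true → degree A v ≡ 1ℤ
  degree-pendant A {v} {u} atMostOne vu = trans (sum-pointSupported (λ u′ → χ (A v u′)) u off) (cong χ vu)
    where off : ∀ u′ → u′ ≢ u → χ (A v u′) ≡ 0ℤ
          off u′ u′≢u with A v u′ in vu′
          ... | true  = ⊥-elim (u′≢u (atMostOne vu′ vu))
          ... | false = refl

  degreeSum-punchIn : ∀ {m} {A : Graph (suc m)} → Symmetric A → Loopless A → ∀ v →
    sum (degree A) ≡ degree A v + degree A v + sum (degree (induced A (punchIn v)))
  degreeSum-punchIn {m} {A} A-sym loopless v = begin
    sum (degree A)
      ≡⟨ sum-remove (degree A) ⟩
    degree A v + sum (λ y → degree A (punchIn v y))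
      ≡⟨ cong (_+_ (degree A v)) (sum-cong-≗ (λ y → sum-remove (λ u → χ (A (punchIn v y) u)))) ⟩
    degree A v + sum (λ y → χ (A (punchIn v y) v) + degree A∖v y)
      ≡⟨ cong (_+_ (degree A v)) (∑-distrib-+ (λ y → χ (A (punchIn v y) v)) (degree A∖v)) ⟩
    degree A v + (sum (λ y → χ (A (punchIn v y) v)) + sum (degree A∖v))
      ≡⟨ cong (λ d → degree A v + (d + sum (degree A∖v))) edgesAt-v ⟩
    degree A v + (degree A v + sum (degree A∖v))
      ≡⟨ +-assoc (degree A v) (degree A v) (sum (degree A∖v)) ⟨
    degree A v + degree A v + sum (degree A∖v) ∎
    where
    A∖v = induced A (punchIn v)
    edgesAt-v : sum (λ y → χ (A (punchIn v y) v)) ≡ degree A v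
    edgesAt-v = begin
      sum (λ y → χ (A (punchIn v y) v))
        ≡⟨ sum-cong-≗ (λ y → cong χ (A-sym (punchIn v y) v)) ⟩
      sum (λ y → χ (A v (punchIn v y)))
        ≡⟨ +-identityˡ _ ⟨
      0ℤ + sum (λ y → χ (A v (punchIn v y)))
        ≡⟨ cong (λ b → χ b + sum (λ y → χ (A v (punchIn v y)))) (loopless v) ⟨
      χ (A v v) + sum (λ y → χ (A v (punchIn v y)))
        ≡⟨ sum-remove (λ u → χ (A v u)) ⟨
      degree A v ∎

  -- A walk through v enters and leaves it along its only edge, so that detour can be cut out.
  punchIn-reach : ∀ {m} {A : Graph (suc m)} → Symmetric A → ∀ {v} → AtMostOneNeighbour A v →
    ∀ {x y} → Reach A (punchIn v x) (punchIn v y) → Reach (induced A (punchIn v)) x y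
  punchIn-reach {A = A} A-sym {v} atMostOne r = avoid r refl refl
    where
    avoid : ∀ {a b x y} → Reach A a b → a ≡ punchIn v x → b ≡ punchIn v y → Reach (induced A (punchIn v)) x y
    avoid {x = x} {y} here a≡ b≡ = subst (Reach _ x) (punchIn-injective v x y (trans (sym a≡) b≡)) here
    avoid (step {w = w} e r) a≡ b≡ with v ≟ w
    ... | no v≢w = step (subst₂ (λ p q → A p q ≡ true) a≡ (sym (punchIn-punchOut v≢w)) e)
                        (avoid r (sym (punchIn-punchOut v≢w)) b≡)
    avoid {y = y} (step e here) a≡ b≡ | yes refl = ⊥-elim (punchInᵢ≢i v y (sym b≡))
    avoid (step {u = a} e (step e′ r)) a≡ b≡ | yes refl =
      avoid r (trans (sym (atMostOne (trans (A-sym v a) e) e′)) a≡) b≡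

  punchIn-view : ∀ {m} (v w : Fin (suc m)) → w ≡ v ⊎ ∃ λ z → punchIn v z ≡ w
  punchIn-view v w with v ≟ w
  ... | yes v≡w = inj₁ (sym v≡w)
  ... | no v≢w  = inj₂ (punchOut v≢w , punchIn-punchOut v≢w)

  module _ {m c : ℕ} {A : Graph (suc m)} (A-sym : Symmetric A) {v : Fin (suc m)} where

    labelling-punchIn-pendant : Loopless A → AtMostOneNeighbour A v → ∀ {u} → A v u ≡ true →
      ∀ {f} → ComponentLabelling A c f → ComponentLabelling (induced A (punchIn v)) c (λ y → f (punchIn v y))
    labelling-punchIn-pendant loopless atMostOne {u} vu {f} labelling@(surjective , reach) =
      surjective′ , λ _ _ → (λ eq → punchIn-reach A-sym atMostOne (proj₁ (reach _ _) eq))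
                          , (λ r → proj₂ (reach _ _) (induced-reach A (punchIn v) r))
      where
      surjective′ : ∀ i → ∃ λ y → f (punchIn v y) ≡ i
      surjective′ i with x , fx≡i ← surjective i with punchIn-view v x
      ... | inj₂ (z , refl) = z , fx≡i
      ... | inj₁ refl with punchIn-view v u
      ...   | inj₁ refl       = ⊥-elim (true≢false (trans (sym vu) (loopless v)))
      ...   | inj₂ (z , refl) = z , trans (sym (adjacent⇒sameLabel labelling vu)) fx≡i

    labelling-punchIn-isolated : (∀ u → A v u ≡ false) → ∀ {f} → ComponentLabelling A (suc c) f →
      ∃ λ g → ComponentLabelling (induced A (punchIn v)) c g
    labelling-punchIn-isolated isolated {f} (surjective , reach) =
      (λ y → punchOut (separated y)) , surjective′ , λ y₁ y₂ →
        (λ eq → punchIn-reach A-sym atMostOne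
                  (proj₁ (reach _ _) (punchOut-injective (separated y₁) (separated y₂) eq)))
      , (λ r → punchOut-cong (f v) (proj₂ (reach _ _) (induced-reach A (punchIn v) r)))
      where
      atMostOne : AtMostOneNeighbour A v
      atMostOne {u} e _ = ⊥-elim (true≢false (trans (sym e) (isolated u)))
      separated : ∀ y → f v ≢ f (punchIn v y)
      separated y fv≡fy = leave (proj₁ (reach _ _) fv≡fy) refl refl
        where leave : ∀ {a b} → Reach A a b → a ≡ v → b ≢ punchIn v y
              leave here a≡v b≡y = punchInᵢ≢i v y (trans (sym b≡y) a≡v)
              leave (step {w = w} e _) refl _ = true≢false (trans (sym e) (isolated w))
      surjective′ : ∀ j → ∃ λ y → punchOut (separated y) ≡ j
      surjective′ j with x , fx≡ ← surjective (punchIn (f v) j) with punchIn-view v x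
      ... | inj₁ refl       = ⊥-elim (punchInᵢ≢i (f v) j (sym fx≡))
      ... | inj₂ (z , refl) = z , trans (punchOut-cong (f v) fx≡) (punchOut-punchIn (f v))

  forest-degreeSum : ∀ {m c} {A : Graph m} {f} → Symmetric A → Loopless A → Acyclic A → ComponentLabelling A c f →
    sum (degree A) ≡ + 2 * (+ m - + c)
  forest-degreeSum {zero}  {zero}  _ _ _ _ = refl
  forest-degreeSum {zero}  {suc c} _ _ _ (surjective , _) with () ← surjective zero
  forest-degreeSum {suc m} {zero}  {f = f} _ _ _ _ with () ← f zero
  forest-degreeSum {suc m} {suc c} {A} A-sym loopless acyclic labelling
    with v , atMostOne ← acyclic⇒atMostOneNeighbour loopless acyclic zero
    with neighbour-or-isolated A v
  ... | inj₁ (u , vu) = begin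
    sum (degree A)
      ≡⟨ degreeSum-punchIn A-sym loopless v ⟩
    degree A v + degree A v + sum (degree A∖v)
      ≡⟨ cong₂ (λ d s → d + d + s) (degree-pendant A atMostOne vu) IH ⟩
    1ℤ + 1ℤ + + 2 * (+ m - + suc c)
      ≡⟨ count (+ m) (+ suc c) ⟩
    + 2 * (+ suc m - + suc c) ∎
    where
    A∖v = induced A (punchIn v)
    IH = forest-degreeSum (λ _ _ → A-sym _ _) (λ _ → loopless _)
           (induced-acyclic A (punchIn-injective v _ _) acyclic)
           (labelling-punchIn-pendant A-sym loopless atMostOne vu labelling)
    count : ∀ M C → 1ℤ + 1ℤ + + 2 * (M - C) ≡ + 2 * ((1ℤ + M) - C)
    count = solve-∀
  ... | inj₂ isolated with g , labelling′ ← labelling-punchIn-isolated A-sym isolated labelling = begin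
    sum (degree A)                             ≡⟨ degreeSum-punchIn A-sym loopless v ⟩
    degree A v + degree A v + sum (degree A∖v) ≡⟨ cong₂ (λ d s → d + d + s) (degree-isolated A isolated) IH ⟩
    0ℤ + 0ℤ + + 2 * (+ m - + c)                ≡⟨ count (+ m) (+ c) ⟩
    + 2 * (+ suc m - + suc c)                  ∎
    where
    A∖v = induced A (punchIn v)
    IH = forest-degreeSum (λ _ _ → A-sym _ _) (λ _ → loopless _)
           (induced-acyclic A (punchIn-injective v _ _) acyclic) labelling′
    count : ∀ M C → 0ℤ + 0ℤ + + 2 * (M - C) ≡ + 2 * ((1ℤ + M) - (1ℤ + C))
    count = solve-∀

module PendantMatchings where

  open IntegerMatrices
  open GraphBasics
  open import Data.Bool using (not)
  open import Data.Integer using (+_; _+_; _-_; _*_; 0ℤ; 1ℤ)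
  open import Data.Integer.Properties using (*-zeroˡ; *-identityˡ; *-identityʳ)
  open import Data.Integer.Tactic.RingSolver using (solve-∀)
  open ≡-Reasoning

  -- A graph presented as H ⊙ K₁: leaf marks the added pendant vertices, and mate is the involution
  -- pairing every vertex of H with its pendant vertex.
  record PendantMatching {n} (A : Graph n) : Set where
    field
      leaf : Fin n → Bool
      mate : Fin n → Fin n
      mate-adjacent      : ∀ v → A v (mate v) ≡ true
      leaf-mate          : ∀ v → leaf (mate v) ≡ not (leaf v)
      leaf-adjacent⇒mate : ∀ {v u} → leaf v ≡ true → A v u ≡ true → u ≡ mate v
      adjacent-leaf⇒mate : ∀ {v u} → A v u ≡ true → leaf u ≡ true → u ≡ mate v

  module _ {n} {A : Graph n} (A-sym : Symmetric A) (pm : PendantMatching A) where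

    open PendantMatching pm

    private
      M = adjacencyMatrix A

    χleaf χcore : Vector ℤ n
    χleaf v = χ (leaf v)
    χcore v = χ (not (leaf v))

    mate-involutive : ∀ v → mate (mate v) ≡ v
    mate-involutive v with leaf v in lv
    ... | true  = sym (adjacent-leaf⇒mate mate-v lv)
      where mate-v = trans (A-sym (mate v) v) (mate-adjacent v)
    ... | false = sym (leaf-adjacent⇒mate (trans (leaf-mate v) (cong not lv)) mate-v)
      where mate-v = trans (A-sym (mate v) v) (mate-adjacent v)

    leaf⇒·ᵥ≡mate : ∀ {v} → leaf v ≡ true → ∀ (h : Vector ℤ n) → (M ·ᵥ h) v ≡ h (mate v)
    leaf⇒·ᵥ≡mate {v} lv h = begin
      (M ·ᵥ h) v                    ≡⟨ sum-pointSupported (λ u → χ (A v u) * h u) (mate v) off ⟩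
      χ (A v (mate v)) * h (mate v) ≡⟨ cong (λ b → χ b * h (mate v)) (mate-adjacent v) ⟩
      1ℤ * h (mate v)               ≡⟨ *-identityˡ (h (mate v)) ⟩
      h (mate v)                    ∎
      where off : ∀ u → u ≢ mate v → χ (A v u) * h u ≡ 0ℤ
            off u u≢mate with A v u in vu
            ... | true  = ⊥-elim (u≢mate (leaf-adjacent⇒mate lv vu))
            ... | false = *-zeroˡ (h u)

    ·ᵥ-onLeaves : ∀ (h : Vector ℤ n) v → (M ·ᵥ (λ u → χleaf u * h u)) v ≡ χcore v * h (mate v)
    ·ᵥ-onLeaves h v = begin
      (M ·ᵥ (λ u → χleaf u * h u)) v
        ≡⟨ sum-pointSupported (λ u → χ (A v u) * (χleaf u * h u)) (mate v) off ⟩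
      χ (A v (mate v)) * (χ (leaf (mate v)) * h (mate v))
        ≡⟨ cong₂ (λ a l → χ a * (χ l * h (mate v))) (mate-adjacent v) (leaf-mate v) ⟩
      1ℤ * (χcore v * h (mate v))
        ≡⟨ *-identityˡ (χcore v * h (mate v)) ⟩
      χcore v * h (mate v) ∎
      where off : ∀ u → u ≢ mate v → χ (A v u) * (χleaf u * h u) ≡ 0ℤ
            off u u≢mate with A v u in vu | leaf u in lu
            ... | false | _     = *-zeroˡ (χleaf u * h u)
            ... | true  | true  = ⊥-elim (u≢mate (adjacent-leaf⇒mate vu lu))
            ... | true  | false = trans (*-identityˡ (0ℤ * h u)) (*-zeroˡ (h u))

    -- At a leaf v the equation (M ·ᵥ y) v = b v reads y (mate v) = b v, which fixes y on the core;
    -- the values at the leaves are then forced by the equations at the core vertices.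
    inverse : Vector ℤ n → Vector ℤ n
    inverse b v = b (mate v) - χleaf v * (M ·ᵥ (λ u → χcore u * b (mate u))) (mate v)

    ·ᵥ-inverse : ∀ b v → (M ·ᵥ inverse b) v ≡ b v
    ·ᵥ-inverse b v = begin
      (M ·ᵥ inverse b) v
        ≡⟨ ·ᵥ-sub M (λ u → b (mate u)) (λ u → χleaf u * g (mate u)) v ⟩
      (M ·ᵥ (λ u → b (mate u))) v - (M ·ᵥ (λ u → χleaf u * g (mate u))) v
        ≡⟨ cong₂ _-_ M·ᵥb∘mate (·ᵥ-onLeaves (λ u → g (mate u)) v) ⟩
      g v + χcore v * b (mate (mate v)) - χcore v * g (mate (mate v))
        ≡⟨ cong (λ u → g v + χcore v * b u - χcore v * g u) (mate-involutive v) ⟩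
      g v + χcore v * b v - χcore v * g v
        ≡⟨ byLeaf ⟩
      b v ∎
      where
      g : Vector ℤ n
      g = M ·ᵥ (λ u → χcore u * b (mate u))
      M·ᵥb∘mate : (M ·ᵥ (λ u → b (mate u))) v ≡ g v + χcore v * b (mate (mate v))
      M·ᵥb∘mate = begin
        (M ·ᵥ (λ u → b (mate u))) v
          ≡⟨ ·ᵥ-cong M (λ u → split (leaf u) (b (mate u))) v ⟩
        (M ·ᵥ (λ u → χcore u * b (mate u) + χleaf u * b (mate u))) v
          ≡⟨ ·ᵥ-+ M (λ u → χcore u * b (mate u)) (λ u → χleaf u * b (mate u)) v ⟩
        g v + (M ·ᵥ (λ u → χleaf u * b (mate u))) v
          ≡⟨ cong (_+_ (g v)) (·ᵥ-onLeaves (λ u → b (mate u)) v) ⟩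
        g v + χcore v * b (mate (mate v)) ∎
        where split : ∀ l x → x ≡ χ (not l) * x + χ l * x
              split true  = solve-∀
              split false = solve-∀
      byLeaf : g v + χcore v * b v - χcore v * g v ≡ b v
      byLeaf with leaf v in lv
      ... | true  = trans (cancel (g v) (b v) (g v)) (begin
        g v
          ≡⟨ leaf⇒·ᵥ≡mate lv (λ u → χcore u * b (mate u)) ⟩
        χ (not (leaf (mate v))) * b (mate (mate v))
          ≡⟨ cong₂ (λ l u → χ (not l) * b u) (leaf-mate v) (mate-involutive v) ⟩
        χ (not (not (leaf v))) * b v
          ≡⟨ cong (λ l → χ (not (not l)) * b v) lv ⟩
        1ℤ * b v
          ≡⟨ *-identityˡ (b v) ⟩
        b v ∎)
        where cancel : ∀ a b c → a + 0ℤ * b - 0ℤ * c ≡ a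
              cancel = solve-∀
      ... | false = cancel (g v) (b v)
        where cancel : ∀ a b → a + 1ℤ * b - 1ℤ * a ≡ b
              cancel = solve-∀

    M·ᵥones : ∀ v → (M ·ᵥ ones) v ≡ degree A v
    M·ᵥones v = sum-cong-≗ (λ u → *-identityʳ (χ (A v u)))

    M·ᵥχleaf : ∀ v → (M ·ᵥ χleaf) v ≡ χcore v
    M·ᵥχleaf v = begin
      (M ·ᵥ χleaf) v                ≡⟨ ·ᵥ-cong M (λ u → sym (*-identityʳ (χleaf u))) v ⟩
      (M ·ᵥ (λ u → χleaf u * 1ℤ)) v ≡⟨ ·ᵥ-onLeaves ones v ⟩
      χcore v * 1ℤ                  ≡⟨ *-identityʳ (χcore v) ⟩
      χcore v                       ∎

    ⟨χcore,M·ᵥχcore⟩ : ⟨ χcore , M ·ᵥ χcore ⟩ ≡ sum (degree A) - + n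
    ⟨χcore,M·ᵥχcore⟩ = begin
      ⟨ χcore , M ·ᵥ χcore ⟩                       ≡⟨ sum-cong-≗ (λ v → cong (χcore v *_) (M·ᵥχcore v)) ⟩
      sum (λ v → χcore v * (degree A v - χcore v)) ≡⟨ sum-cong-≗ χcore*[degree-χcore] ⟩
      sum (λ v → degree A v - 1ℤ)                  ≡⟨ sum-sub (degree A) ones ⟩
      sum (degree A) - sum (ones {n})              ≡⟨ cong (_-_ (sum (degree A))) (sum-ones n) ⟩
      sum (degree A) - + n                         ∎
      where
      M·ᵥχcore : ∀ v → (M ·ᵥ χcore) v ≡ degree A v - χcore v
      M·ᵥχcore v = begin
        (M ·ᵥ χcore) v                ≡⟨ ·ᵥ-cong M (λ u → χ-not (leaf u)) v ⟩
        (M ·ᵥ (λ u → 1ℤ - χleaf u)) v ≡⟨ ·ᵥ-sub M ones χleaf v ⟩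
        (M ·ᵥ ones) v - (M ·ᵥ χleaf) v ≡⟨ cong₂ _-_ (M·ᵥones v) (M·ᵥχleaf v) ⟩
        degree A v - χcore v          ∎
        where χ-not : ∀ l → χ (not l) ≡ 1ℤ - χ l
              χ-not true  = refl
              χ-not false = refl
      χcore*[degree-χcore] : ∀ v → χcore v * (degree A v - χcore v) ≡ degree A v - 1ℤ
      χcore*[degree-χcore] v with leaf v in lv
      ... | true  = sym (cong (_- 1ℤ) (trans (sym (M·ᵥones v)) (leaf⇒·ᵥ≡mate lv ones)))
      ... | false = *-identityˡ (degree A v - 1ℤ)

    sum-inverse-ones : sum (inverse ones) ≡ + 2 * + n - sum (degree A)
    sum-inverse-ones = begin
      sum (inverse ones)
        ≡⟨ sum-sub ones (λ v → χleaf v * g (mate v)) ⟩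
      sum (ones {n}) - sum (λ v → χleaf v * g (mate v))
        ≡⟨ cong₂ _-_ (sum-ones n) (sum-cong-≗ throughLeaves) ⟩
      + n - ⟨ χleaf , M ·ᵥ M ·ᵥ χcore ⟩
        ≡⟨ cong (_-_ (+ n)) (⟨⟩-adjoint M (λ u v → cong χ (A-sym u v)) χleaf (M ·ᵥ χcore)) ⟩
      + n - ⟨ M ·ᵥ χleaf , M ·ᵥ χcore ⟩
        ≡⟨ cong (_-_ (+ n)) (sum-cong-≗ (λ v → cong (_* (M ·ᵥ χcore) v) (M·ᵥχleaf v))) ⟩
      + n - ⟨ χcore , M ·ᵥ χcore ⟩
        ≡⟨ cong (_-_ (+ n)) ⟨χcore,M·ᵥχcore⟩ ⟩
      + n - (sum (degree A) - + n)
        ≡⟨ rearrange (+ n) (sum (degree A)) ⟩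
      + 2 * + n - sum (degree A) ∎
      where
      g : Vector ℤ n
      g = M ·ᵥ (λ u → χcore u * 1ℤ)
      throughLeaves : ∀ v → χleaf v * g (mate v) ≡ χleaf v * (M ·ᵥ M ·ᵥ χcore) v
      throughLeaves v with leaf v in lv
      ... | true  = cong (_*_ 1ℤ) (trans (·ᵥ-cong M (λ u → *-identityʳ (χcore u)) (mate v))
                                         (sym (leaf⇒·ᵥ≡mate lv (M ·ᵥ χcore))))
      ... | false = trans (*-zeroˡ (g (mate v))) (sym (*-zeroˡ ((M ·ᵥ M ·ᵥ χcore) v)))
      rearrange : ∀ N D → N - (D - N) ≡ + 2 * N - D
      rearrange = solve-∀

module PendantStructure where

  open GraphBasics
  open PendantMatchings using (PendantMatching)
  open import Data.Bool using (not)
  open import Data.Fin using (splitAt; join; inject₁; fromℕ)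
  open import Data.Fin.Properties using (splitAt-join; join-splitAt)
  open import Data.Sum using (_⊎_; inj₁; inj₂; swap)
  open import Data.Product using (∃; _×_; _,_; proj₁; proj₂)
  open import Function.Definitions using (Injective)

  module _ {k} (H : Graph k) where

    private
      adjacent⊎ : Fin k ⊎ Fin k → Fin k ⊎ Fin k → Bool
      adjacent⊎ (inj₁ a) (inj₁ b) = H a b
      adjacent⊎ (inj₁ a) (inj₂ b) = ⌊ a ≟ b ⌋
      adjacent⊎ (inj₂ a) (inj₁ b) = ⌊ a ≟ b ⌋
      adjacent⊎ (inj₂ a) (inj₂ b) = false

      pendant⊎ : Fin k ⊎ Fin k → Bool
      pendant⊎ (inj₁ _) = false
      pendant⊎ (inj₂ _) = true

      corona≡adjacent⊎ : ∀ y z → corona H y z ≡ adjacent⊎ (splitAt k y) (splitAt k z)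
      corona≡adjacent⊎ y z with splitAt k y | splitAt k z
      ... | inj₁ _ | inj₁ _ = refl
      ... | inj₁ _ | inj₂ _ = refl
      ... | inj₂ _ | inj₁ _ = refl
      ... | inj₂ _ | inj₂ _ = refl

      adjacent⊎-swap : ∀ s → adjacent⊎ s (swap s) ≡ true
      adjacent⊎-swap (inj₁ a) = ⌊≟⌋-refl a
      adjacent⊎-swap (inj₂ a) = ⌊≟⌋-refl a

      pendant⊎-swap : ∀ s → pendant⊎ (swap s) ≡ not (pendant⊎ s)
      pendant⊎-swap (inj₁ _) = refl
      pendant⊎-swap (inj₂ _) = refl

      pendant-adjacent⊎⇒swap : ∀ {s t} → pendant⊎ s ≡ true → adjacent⊎ s t ≡ true → t ≡ swap s
      pendant-adjacent⊎⇒swap {inj₂ a} {inj₁ b} _ a≟b = cong inj₁ (sym (⌊≟⌋⇒≡ a≟b))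

      adjacent-pendant⊎⇒swap : ∀ {s t} → adjacent⊎ s t ≡ true → pendant⊎ t ≡ true → t ≡ swap s
      adjacent-pendant⊎⇒swap {inj₁ a} {inj₂ b} a≟b _ = cong inj₂ (sym (⌊≟⌋⇒≡ a≟b))

      corona⇒adjacent⊎ : ∀ {y z} → corona H y z ≡ true → adjacent⊎ (splitAt k y) (splitAt k z) ≡ true
      corona⇒adjacent⊎ {y} {z} yz = trans (sym (corona≡adjacent⊎ y z)) yz

    corona-pendantMatching : PendantMatching (corona H)
    corona-pendantMatching = record
      { leaf = λ y → pendant⊎ (splitAt k y)
      ; mate = λ y → join k k (swap (splitAt k y))
      ; mate-adjacent = λ y → trans (corona≡adjacent⊎ y _)
          (trans (cong (adjacent⊎ (splitAt k y)) (splitAt-join k k _)) (adjacent⊎-swap (splitAt k y)))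
      ; leaf-mate = λ y → trans (cong pendant⊎ (splitAt-join k k _)) (pendant⊎-swap (splitAt k y))
      ; leaf-adjacent⇒mate = λ {y} {z} ly yz → trans (sym (join-splitAt k k z))
          (cong (join k k) (pendant-adjacent⊎⇒swap {splitAt k y} ly (corona⇒adjacent⊎ yz)))
      ; adjacent-leaf⇒mate = λ {y} {z} yz lz → trans (sym (join-splitAt k k z))
          (cong (join k k) (adjacent-pendant⊎⇒swap {splitAt k y} (corona⇒adjacent⊎ yz) lz))
      }

  isomorphic-pendantMatching : ∀ {m n} {G : Graph m} {H : Graph n} →
                               Isomorphic G H → PendantMatching H → PendantMatching G
  isomorphic-pendantMatching {m} {n} {G} {H} (φ , (φ-injective , φ-surjective) , φ-preserves) pm = record
    { leaf = λ v → leaf (φ v)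
    ; mate = λ v → φ⁻¹ (mate (φ v))
    ; mate-adjacent = λ v → trans (sym (φ-preserves v _)) (trans (cong (H (φ v)) (φ∘φ⁻¹ _)) (mate-adjacent (φ v)))
    ; leaf-mate = λ v → trans (cong leaf (φ∘φ⁻¹ _)) (leaf-mate (φ v))
    ; leaf-adjacent⇒mate = λ {v} {u} lv vu →
        φ-injective (trans (leaf-adjacent⇒mate lv (trans (φ-preserves v u) vu)) (sym (φ∘φ⁻¹ _)))
    ; adjacent-leaf⇒mate = λ {v} {u} vu lu →
        φ-injective (trans (adjacent-leaf⇒mate (trans (φ-preserves v u) vu) lu) (sym (φ∘φ⁻¹ _)))
    }
    where
    open PendantMatching pm
    φ⁻¹ : Fin n → Fin m
    φ⁻¹ y = proj₁ (φ-surjective y)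
    φ∘φ⁻¹ : ∀ y → φ (φ⁻¹ y) ≡ y
    φ∘φ⁻¹ y = proj₂ (φ-surjective y) refl

  chain-constant : ∀ {k} {X : Set} (g : Fin (suc k) → X) → (∀ t → g (inject₁ t) ≡ g (suc t)) → ∀ t → g t ≡ g zero
  chain-constant g link zero = refl
  chain-constant {suc k} g link (suc t) =
    trans (sym (link t)) (chain-constant (λ s → g (inject₁ s)) (λ s → link (inject₁ s)) t)

  module Componentwise {n c} {A : Graph n} {f : Fin n → Fin c} (labelling : ComponentLabelling A c f)
    (size : Fin c → ℕ) (ι : ∀ i → Fin (size i) → Fin n) (ι-injective : ∀ i → Injective _≡_ _≡_ (ι i))
    (ι-labels : ∀ i a → f (ι i a) ≡ i) (ι-covers : ∀ i v → f v ≡ i → ∃ λ a → ι i a ≡ v) where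

    components-acyclic : (∀ i → Acyclic (induced A (ι i))) → Acyclic A
    components-acyclic acyclic (k , cycle , cycle-injective , edges , closing) =
      acyclic i (k , lift , lift-injective , edges′ , closing′)
      where
      i = f (cycle zero)
      sameLabel : ∀ t → f (cycle t) ≡ i
      sameLabel = chain-constant (λ t → f (cycle t)) (λ t → adjacent⇒sameLabel labelling (edges t))
      lift : Fin (suc (suc (suc k))) → Fin (size i)
      lift t = proj₁ (ι-covers i (cycle t) (sameLabel t))
      ι∘lift : ∀ t → ι i (lift t) ≡ cycle t
      ι∘lift t = proj₂ (ι-covers i (cycle t) (sameLabel t))
      lift-injective : Injective _≡_ _≡_ lift
      lift-injective {t₁} {t₂} e = cycle-injective (trans (sym (ι∘lift t₁)) (trans (cong (ι i) e) (ι∘lift t₂)))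
      edges′ : ∀ t → induced A (ι i) (lift (inject₁ t)) (lift (suc t)) ≡ true
      edges′ t = trans (cong₂ A (ι∘lift (inject₁ t)) (ι∘lift (suc t))) (edges t)
      closing′ : induced A (ι i) (lift (fromℕ (suc (suc k)))) (lift zero) ≡ true
      closing′ = trans (cong₂ A (ι∘lift _) (ι∘lift zero)) closing

    module _ (pm : ∀ i → PendantMatching (induced A (ι i))) where

      private
        module Local i = PendantMatching (pm i)
        open Local using () renaming (leaf to leafᵢ; mate to mateᵢ)

        position : ∀ v → Fin (size (f v))
        position v = proj₁ (ι-covers (f v) v refl)

        ι∘position : ∀ v → ι (f v) (position v) ≡ v
        ι∘position v = proj₂ (ι-covers (f v) v refl)

        leaf : Fin n → Bool
        leaf v = leafᵢ (f v) (position v)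

        mate : Fin n → Fin n
        mate v = ι (f v) (mateᵢ (f v) (position v))

        -- leaf v is read off in component f v; generalising that index allows matching on f v ≡ i.
        leaf-viaLabel : ∀ {i v} a → ι i a ≡ v → ∀ {j} (e : f v ≡ j) → j ≡ i →
                        leafᵢ j (proj₁ (ι-covers j v e)) ≡ leafᵢ i a
        leaf-viaLabel a ιa≡v e refl = cong (leafᵢ _) (ι-injective _ (trans (proj₂ (ι-covers _ _ e)) (sym ιa≡v)))

        leaf-ι : ∀ {i u} b → ι i b ≡ u → leaf u ≡ leafᵢ i b
        leaf-ι {i} b ιb≡u = leaf-viaLabel b ιb≡u refl (trans (cong f (sym ιb≡u)) (ι-labels i b))

        neighbour : ∀ {v u} → A v u ≡ true → ∃ λ b → ι (f v) b ≡ u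
        neighbour {v} {u} vu = ι-covers (f v) u (sym (adjacent⇒sameLabel labelling vu))

        adjacentᵢ : ∀ {v u b} → A v u ≡ true → ι (f v) b ≡ u → induced A (ι (f v)) (position v) b ≡ true
        adjacentᵢ {v} vu ιb≡u = trans (cong₂ A (ι∘position v) ιb≡u) vu

      components-pendantMatching : PendantMatching A
      components-pendantMatching = record
        { leaf = leaf
        ; mate = mate
        ; mate-adjacent = λ v →
            subst (λ x → A x (mate v) ≡ true) (ι∘position v) (Local.mate-adjacent (f v) (position v))
        ; leaf-mate = λ v → trans (leaf-ι _ refl) (Local.leaf-mate (f v) (position v))
        ; leaf-adjacent⇒mate = λ {v} {u} lv vu → let b , ιb≡u = neighbour vu in
            trans (sym ιb≡u) (cong (ι (f v)) (Local.leaf-adjacent⇒mate (f v) lv (adjacentᵢ vu ιb≡u)))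
        ; adjacent-leaf⇒mate = λ {v} {u} vu lu → let b , ιb≡u = neighbour vu in
            trans (sym ιb≡u) (cong (ι (f v))
              (Local.adjacent-leaf⇒mate (f v) (adjacentᵢ vu ιb≡u) (trans (sym (leaf-ι b ιb≡u)) lu)))
        }

  pendantTreeComponents⇒matching×acyclic : ∀ {n c} {A : Graph n} {f} → ComponentLabelling A c f →
    (∀ i → ComponentIsPendantTree A f i) → PendantMatching A × Acyclic A
  pendantTreeComponents⇒matching×acyclic {A = A} labelling components =
      components-pendantMatching (λ i → let _ , H , iso = pendantTree i .proj₁ in
                                          isomorphic-pendantMatching iso (corona-pendantMatching H))
    , components-acyclic (λ i → pendantTree i .proj₂ .proj₂)
    where
    open Componentwise labelling (λ i → components i .proj₁) (λ i → components i .proj₂ .proj₁)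
      (λ i → components i .proj₂ .proj₂ .proj₁) (λ i → components i .proj₂ .proj₂ .proj₂ .proj₁)
      (λ i → components i .proj₂ .proj₂ .proj₂ .proj₂ .proj₁)
    pendantTree : ∀ i → IsPendantTree (induced A (components i .proj₂ .proj₁))
    pendantTree i = components i .proj₂ .proj₂ .proj₂ .proj₂ .proj₂

module NeighbourhoodLightsOut where

  open IntegerMatrices
  open GraphBasics
  open import Data.Bool using (if_then_else_)
  open import Data.Fin using (toℕ)
  open import Data.Integer using (+_; _+_; _-_; -_; _*_; 0ℤ; 1ℤ)
  open import Data.Integer.DivMod using (_%ℕ_; _/ℕ_; a≡a%ℕn+[a/ℕn]*n)
  open import Data.Integer.Divisibility.Signed using (_∣_; divides; ∣ᵤ⇒∣; ∣⇒∣ᵤ; ∣m∣n⇒∣m+n; ∣n⇒∣m*n)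
  open import Data.Integer.Tactic.RingSolver using (solve-∀)
  open import Data.Product using (∃; _,_)
  open ≡-Reasoning

  ∣[%ℕ]-self : ∀ ℓ .{{_ : ℕ.NonZero ℓ}} X → + ℓ ∣ + (X %ℕ ℓ) - X
  ∣[%ℕ]-self ℓ X = divides (- (X /ℕ ℓ)) (begin
    + (X %ℕ ℓ) - X                           ≡⟨ cong (_-_ (+ (X %ℕ ℓ))) (a≡a%ℕn+[a/ℕn]*n X ℓ) ⟩
    + (X %ℕ ℓ) - (+ (X %ℕ ℓ) + X /ℕ ℓ * + ℓ) ≡⟨ cancel (+ (X %ℕ ℓ)) (X /ℕ ℓ) (+ ℓ) ⟩
    - (X /ℕ ℓ) * + ℓ                         ∎)
    where cancel : ∀ r q l → r - (r + q * l) ≡ - q * l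
          cancel = solve-∀

  module _ {n} (G : Graph n) where

    private
      M = adjacencyMatrix (complement G)

    NAW⇒solvable : ∀ {ℓ} → NAW G (suc (suc ℓ)) → ∀ a → ∃ λ x → ∀ v → + suc (suc ℓ) ∣ unit a v + (J- M ·ᵥ x) v
    NAW⇒solvable naw a with x , ℓ∣ ← naw (λ v → if ⌊ v ≟ a ⌋ then suc zero else zero) =
      (λ u → + x u) , λ v → subst (_ ∣_) (cong₂ _+_ (label ⌊ v ≟ a ⌋) (toggleEffect≡J-Ḡ·ᵥ G x v)) (∣ᵤ⇒∣ (ℓ∣ v))
      where label : ∀ β → + toℕ {suc (suc _)} (if β then suc zero else zero) ≡ (if β then 1ℤ else 0ℤ)
            label true  = refl
            label false = refl

    solvable⇒NAW : ∀ {ℓ} .{{_ : ℕ.NonZero ℓ}} → (∀ b → ∃ λ x → ∀ v → + ℓ ∣ b v + (J- M ·ᵥ x) v) → NAW G ℓ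
    solvable⇒NAW {ℓ} solvable b with X , ℓ∣ ← solvable (λ v → + toℕ (b v)) = x , λ v →
      ∣⇒∣ᵤ (subst (+ ℓ ∣_) (reduced v)
        (∣m∣n⇒∣m+n (ℓ∣ v) (∣-sum _ (λ u → ∣n⇒∣m*n ((J- M) v u) (∣[%ℕ]-self ℓ (X u))))))
      where
      x : Fin n → ℕ
      x u = X u %ℕ ℓ
      reduced : ∀ v → + toℕ (b v) + (J- M ·ᵥ X) v + (J- M ·ᵥ (λ u → + x u - X u)) v
                    ≡ + toℕ (b v) + + toggleEffect G x v
      reduced v = begin
        + toℕ (b v) + (J- M ·ᵥ X) v + (J- M ·ᵥ (λ u → + x u - X u)) v
          ≡⟨ cong (_+_ (+ toℕ (b v) + (J- M ·ᵥ X) v)) (·ᵥ-sub (J- M) (λ u → + x u) X v) ⟩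
        + toℕ (b v) + (J- M ·ᵥ X) v + ((J- M ·ᵥ (λ u → + x u)) v - (J- M ·ᵥ X) v)
          ≡⟨ cancel (+ toℕ (b v)) ((J- M ·ᵥ X) v) ((J- M ·ᵥ (λ u → + x u)) v) ⟩
        + toℕ (b v) + (J- M ·ᵥ (λ u → + x u)) v
          ≡⟨ cong (_+_ (+ toℕ (b v))) (toggleEffect≡J-Ḡ·ᵥ G x v) ⟨
        + toℕ (b v) + + toggleEffect G x v ∎
        where cancel : ∀ β y z → β + y + (z - y) ≡ β + z
              cancel = solve-∀

open import Data.Nat using (ℕ; suc; _*_; _∸_; _≤_)
open import Data.Nat.GCD using (gcd)
open import Data.Fin using (Fin)
open import Relation.Binary.PropositionalEquality using (_≡_)
open import Function.Bundles using (_⇔_)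

open import Data.Nat using (s≤s)
open import Data.Integer as ℤ using (+_; 0ℤ; 1ℤ)
open import Data.Integer.Tactic.RingSolver using (solve-∀)
open import Data.Product using (_,_; proj₁; proj₂)
open import Function.Bundles using (mk⇔)
open IntegerMatrices using (sum; ones)
open GraphBasics using (χ; adjacencyMatrix; degree; complement-symmetric; complement-loopless)
open Forests using (forest-degreeSum)
open PendantMatchings using (inverse; ·ᵥ-inverse; sum-inverse-ones)
open PendantStructure using (pendantTreeComponents⇒matching×acyclic)
open NeighbourhoodLightsOut using (NAW⇒solvable; solvable⇒NAW)
open ≡-Reasoning

corollary3p11 : (ℓ : ℕ) → 2 ≤ ℓ → (n : ℕ) → 1 ≤ n → (G : Graph n) → IsSimple G →
    (c : ℕ) → (f : Fin n → Fin c) → ComponentLabelling (complement G) c f →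
    (∀ i → ComponentIsPendantTree (complement G) f i) →
    NAW G ℓ ⇔ (gcd (2 * c ∸ 1) ℓ ≡ 1)
corollary3p11 _ (s≤s (s≤s _)) (suc n) (s≤s _) G _ zero f _ _ with () ← f zero
corollary3p11 _ (s≤s (s≤s _)) (suc n) (s≤s _) G (G-sym , _) (suc c) f labelling components =
  mk⇔ (λ naw → solvable⇒coprime Σw-1≡2c-1 zero (NAW⇒solvable G naw))
      (λ gcd≡1 → solvable⇒NAW G (coprime⇒solvable Σw-1≡2c-1 gcd≡1))
  where
  A = complement G
  A-sym = complement-symmetric G-sym
  matching×acyclic = pendantTreeComponents⇒matching×acyclic labelling components
  matching = proj₁ matching×acyclic
  open SolvabilityOfJ-M (adjacencyMatrix A) (λ u v → cong χ (A-sym u v))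
                        (inverse A-sym matching) (·ᵥ-inverse A-sym matching)
  -- Since c ≥ 1 the truncated 2 * suc c ∸ 1 unfolds to c + suc (c + 0), the right-hand side of count.
  Σw-1≡2c-1 : sum w ℤ.- 1ℤ ≡ + (2 * suc c ∸ 1)
  Σw-1≡2c-1 = begin
    sum (inverse A-sym matching ones) ℤ.- 1ℤ
      ≡⟨ cong (ℤ._- 1ℤ) (sum-inverse-ones A-sym matching) ⟩
    + 2 ℤ.* + suc n ℤ.- sum (degree A) ℤ.- 1ℤ
      ≡⟨ cong (λ D → + 2 ℤ.* + suc n ℤ.- D ℤ.- 1ℤ)
              (forest-degreeSum A-sym (complement-loopless G) (proj₂ matching×acyclic) labelling) ⟩
    + 2 ℤ.* + suc n ℤ.- + 2 ℤ.* (+ suc n ℤ.- + suc c) ℤ.- 1ℤ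
      ≡⟨ count (+ suc n) (+ c) ⟩
    + (2 * suc c ∸ 1) ∎
    where count : ∀ N C → + 2 ℤ.* N ℤ.- + 2 ℤ.* (N ℤ.- (1ℤ ℤ.+ C)) ℤ.- 1ℤ ≡ C ℤ.+ (1ℤ ℤ.+ (C ℤ.+ 0ℤ))
          count = solve-∀
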